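{- If a crown-free linear $3$-graph $H$ on $n$ vertices contains no critical configuration, then $|E(H)| \leq \frac{3n}{2}$.
   Context: A (linear) $3$-graph $H=(V,E)$ consists of a finite vertex set $V$ and a set $E$ of $3$-element subsets of $V$ (edges) such that any two distinct edges intersect in at most one vertex; the degree of a vertex in a $3$-graph is the number of its edges containing it. A crown is the $3$-graph consisting of three pairwise disjoint edges together with a fourth edge intersecting each of them; $H$ is crown-free if no four edges of $H$ form a crown. For an edge $e=\{a,b,c\}$ of a $3$-graph, $D(e)$ is the vector of the degrees of $a,b,c$ arranged in non-increasing order. A critical configuration in a crown-free $3$-graph is the set of $9$ edges consisting of an edge $e$ together with the edges incident to $e$, in a (crown-free) $3$-graph in which $D(e) = (4,4,3)$ or $D(e) = (5,4,2)$; $H$ contains a critical configuration if some sub-$3$-graph of $H$ (a subset of its edges) is such a configuration. -}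

module Defs where

open import Data.Nat using (ℕ; _≤_)
open import Data.Fin using (Fin)
open import Data.Fin.Subset using (Subset; _∈_; _∩_; _∪_; ⁅_⁆; ∣_∣; Nonempty; Empty)
open import Data.Fin.Subset.Properties using (_∈?_)
open import Data.List using (List; length; filter)
import Data.List.Membership.Propositional as LM
open import Data.List.Relation.Unary.All using (All)
open import Data.List.Relation.Unary.Unique.Propositional using (Unique)
open import Data.Product using (Σ; ∃; ∃-syntax; _×_; _,_)
open import Data.Sum using (_⊎_)
open import Relation.Binary.PropositionalEquality using (_≡_; _≢_)
open import Relation.Nullary using (¬_)
open import Function.Bundles using (_⇔_)

record ThreeGraph (n : ℕ) : Set where
  field
    edges  : List (Subset n)
    unique : Unique edges
    size3  : All (λ e → ∣ e ∣ ≡ 3) edges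
    linear : ∀ {e f} → e LM.∈ edges → f LM.∈ edges → e ≢ f → ∣ e ∩ f ∣ ≤ 1

open ThreeGraph public

degree : ∀ {n} → ThreeGraph n → Fin n → ℕ
degree H v = length (filter (λ e → v ∈? e) (edges H))

Meets : ∀ {n} → Subset n → Subset n → Set
Meets e f = Nonempty (e ∩ f)

Disjoint : ∀ {n} → Subset n → Subset n → Set
Disjoint e f = Empty (e ∩ f)

Crown : ∀ {n} → ThreeGraph n → Set
Crown {n} H =
  Σ (Subset n) λ e₁ → Σ (Subset n) λ e₂ → Σ (Subset n) λ e₃ → Σ (Subset n) λ f →
    (e₁ LM.∈ edges H) × (e₂ LM.∈ edges H) × (e₃ LM.∈ edges H) × (f LM.∈ edges H) ×
    Disjoint e₁ e₂ × Disjoint e₁ e₃ × Disjoint e₂ e₃ ×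
    Meets f e₁ × Meets f e₂ × Meets f e₃

CrownFree : ∀ {n} → ThreeGraph n → Set
CrownFree H = ¬ Crown H

-- e = {a, b, c} with a, b, c pairwise distinct and (deg a, deg b, deg c) = (x, y, z);
-- D(e) = (x,y,z) (for x ≥ y ≥ z) iff such a labelling exists.
DegreeVector : ∀ {n} → ThreeGraph n → Subset n → ℕ → ℕ → ℕ → Set
DegreeVector {n} H e x y z =
  Σ (Fin n) λ a → Σ (Fin n) λ b → Σ (Fin n) λ c →
    (a ≢ b) × (a ≢ c) × (b ≢ c) ×
    (e ≡ (⁅ a ⁆ ∪ ⁅ b ⁆) ∪ ⁅ c ⁆) ×
    (degree H a ≡ x) × (degree H b ≡ y) × (degree H c ≡ z)

IsCriticalConfiguration : ∀ {n} → List (Subset n) → Set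
IsCriticalConfiguration {n} F =
  Σ (ThreeGraph n) λ H' → CrownFree H' ×
    Σ (Subset n) λ e → (e LM.∈ edges H') ×
      (DegreeVector H' e 4 4 3 ⊎ DegreeVector H' e 5 4 2) ×
      (∀ f → (f LM.∈ F) ⇔ ((f LM.∈ edges H') × Meets f e))

ContainsCriticalConfiguration : ∀ {n} → ThreeGraph n → Set
ContainsCriticalConfiguration {n} H =
  Σ (List (Subset n)) λ F → (∀ {f} → f LM.∈ F → f LM.∈ edges H) × IsCriticalConfiguration F

-- Discharging with the share w(d) = ⌊12/d⌋: a vertex of degree d hands w(d) to each of its d
-- edges, so it gives away at most 12 and the edges collect at most 12n in total.  Once the
-- degrees (x, y, z) of an edge are sorted, the edge collects at least 8 unless (x, y, z) dominates
-- (4,4,3) or (5,4,2) componentwise.  In the latter case the edge e together with suitably many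
-- edges through each of its vertices is a critical configuration inside H: by linearity no other
-- edge passes through two vertices of e, so the degrees can be cut down to exactly (4,4,3) or
-- (5,4,2), and a sub-3-graph of a crown-free 3-graph is crown-free.  Hence 8|E| ≤ 12n.

module Submission where

open import Defs
open import Data.Nat using (ℕ; zero; suc; _+_; _*_; _/_; _≤_; _<_; _≤?_; z≤n; s≤s; s≤s⁻¹)
open import Data.Nat.Properties
  using (+-0-commutativeMonoid; +-commutativeSemigroup; +-assoc; +-identityʳ; *-comm; *-assoc;
         +-mono-≤; ≤-refl; ≤-trans; <⇒≤; ≰⇒>; <⇒≱; m≤m+n; m≤n+m; m≤n⇒m⊓n≡m; *-cancelˡ-≤; module ≤-Reasoning)
open import Data.Nat.DivMod using (m/n*n≤m; /-monoʳ-≤)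
open import Data.Nat.ListAction using (sum)
open import Algebra.Properties.CommutativeMonoid.Sum +-0-commutativeMonoid
  using (sum-syntax; ∑-distrib-+; sum-cong-≗; sum-replicate-zero)
open import Algebra.Properties.CommutativeSemigroup +-commutativeSemigroup using (xy∙z≈yx∙z; xy∙z≈xz∙y)
open import Data.Bool using (if_then_else_) renaming (_≟_ to _≟ᵇ_)
open import Data.Vec using ([]; _∷_; here; there)
open import Data.Vec.Properties using (≡-dec)
open import Data.Fin using (Fin; zero; suc)
open import Data.Fin.Properties using (suc-injective) renaming (_≟_ to _≟ᶠ_)
open import Data.Fin.Subset using (Subset; inside; outside; ∣_∣; ⁅_⁆; _∪_) renaming (_∈_ to _∈ˢ_; _∉_ to _∉ˢ_)
open import Data.Fin.Subset.Properties
  using (_∈?_; x∈p∪q⁺; x∈p∪q⁻; x∈p∩q⁺; x∈⁅x⁆; x∈⁅y⁆⇒x≡y; ⊆-antisym; ∪-comm; ∪-assoc; x∈p⇒∣p-x∣<∣p∣; x∈p∧x≢y⇒x∈p-y)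
open import Data.List using (List; []; _∷_; _++_; length; map; filter; take)
open import Data.List.Properties
  using (length-map; map-∘; length-++; length-take; filter-accept; filter-reject; filter-all; filter-none; filter-++)
open import Data.List.Membership.Propositional using (_∈_)
open import Data.List.Membership.Propositional.Properties using (∈-map⁺; ∈-map⁻; ∈-filter⁺; ∈-filter⁻)
open import Data.List.Relation.Binary.Subset.Propositional using (_⊆_)
open import Data.List.Relation.Unary.Any using (here; there)
open import Data.List.Relation.Unary.All as All using (All; []; _∷_)
import Data.List.Relation.Unary.All.Properties as AllP
open import Data.List.Relation.Unary.Unique.Propositional using (Unique; []; _∷_)
import Data.List.Relation.Unary.Unique.Propositional.Properties as Unique
open import Data.Product using (Σ-syntax; _×_; _,_; proj₁; proj₂)
open import Data.Sum using (_⊎_; inj₁; inj₂)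
open import Function using (_∘_)
open import Function.Bundles using (mk⇔)
open import Relation.Binary using (DecidableEquality)
open import Relation.Binary.PropositionalEquality
open import Relation.Nullary using (¬_; ¬?; does; yes; no; contradiction)

private variable
  n : ℕ

sum-map-≥ : {A : Set} (k : ℕ) (f : A → ℕ) (xs : List A) → All (λ x → k ≤ f x) xs →
            length xs * k ≤ sum (map f xs)
sum-map-≥ k f []       []            = z≤n
sum-map-≥ k f (x ∷ xs) (k≤fx ∷ k≤fxs) = +-mono-≤ k≤fx (sum-map-≥ k f xs k≤fxs)

take-⊆ : {A : Set} (m : ℕ) (xs : List A) → take m xs ⊆ xs
take-⊆ (suc m) (x ∷ xs) (here x≡)  = here x≡
take-⊆ (suc m) (x ∷ xs) (there y∈) = there (take-⊆ m xs y∈)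

length-filter-≢ : {A : Set} (_≟_ : DecidableEquality A) {x : A} (xs : List A) → Unique xs → x ∈ xs →
                  length xs ≡ suc (length (filter (λ y → ¬? (y ≟ x)) xs))
length-filter-≢ _≟_ (x ∷ xs) (x∉xs ∷ _) (here refl) =
  cong suc (sym (trans (cong length (filter-reject (λ y → ¬? (y ≟ x)) (λ x≢x → x≢x refl)))
                       (cong length (filter-all (λ y → ¬? (y ≟ x)) (All.map ≢-sym x∉xs)))))
length-filter-≢ _≟_ {x} (y ∷ xs) (y∉xs ∷ unique-xs) (there x∈xs) =
  trans (cong suc (length-filter-≢ _≟_ xs unique-xs x∈xs))
        (cong (suc ∘ length) (sym (filter-accept (λ z → ¬? (z ≟ x)) (All.lookup y∉xs x∈xs))))

separated⇒disjoint : {A : Set} {P : A → Set} {xs ys : List A} → All P xs → All (¬_ ∘ P) ys →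
                     ∀ {v} → ¬ (v ∈ xs × v ∈ ys)
separated⇒disjoint Pxs ¬Pys (v∈xs , v∈ys) = All.lookup ¬Pys v∈ys (All.lookup Pxs v∈xs)

∑-≤ : (f : Fin n → ℕ) (k : ℕ) → (∀ v → f v ≤ k) → ∑[ v < n ] f v ≤ n * k
∑-≤ {zero}  f k f≤k = z≤n
∑-≤ {suc n} f k f≤k = +-mono-≤ (f≤k zero) (∑-≤ (λ v → f (suc v)) k (λ v → f≤k (suc v)))

elements : Subset n → List (Fin n)
elements []            = []
elements (inside ∷ p)  = zero ∷ map suc (elements p)
elements (outside ∷ p) = map suc (elements p)

length-elements : (p : Subset n) → length (elements p) ≡ ∣ p ∣
length-elements []            = refl
length-elements (inside ∷ p)  = cong suc (trans (length-map suc (elements p)) (length-elements p))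
length-elements (outside ∷ p) = trans (length-map suc (elements p)) (length-elements p)

∈-elements⁺ : {v : Fin n} (p : Subset n) → v ∈ˢ p → v ∈ elements p
∈-elements⁺ (inside ∷ p)  here        = here refl
∈-elements⁺ (inside ∷ p)  (there v∈p) = there (∈-map⁺ suc (∈-elements⁺ p v∈p))
∈-elements⁺ (outside ∷ p) (there v∈p) = ∈-map⁺ suc (∈-elements⁺ p v∈p)

∈-elements⁻ : {v : Fin n} (p : Subset n) → v ∈ elements p → v ∈ˢ p
∈-elements⁻ (inside ∷ p)  (here refl) = here
∈-elements⁻ (inside ∷ p)  (there v∈)  with ∈-map⁻ suc v∈
... | _ , u∈ , refl = there (∈-elements⁻ p u∈)
∈-elements⁻ (outside ∷ p) v∈          with ∈-map⁻ suc v∈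
... | _ , u∈ , refl = there (∈-elements⁻ p u∈)

elements-unique : (p : Subset n) → Unique (elements p)
elements-unique []            = []
elements-unique (inside ∷ p)  = AllP.map⁺ (All.tabulate (λ _ ())) ∷ Unique.map⁺ suc-injective (elements-unique p)
elements-unique (outside ∷ p) = Unique.map⁺ suc-injective (elements-unique p)

_↾_ : (Fin n → ℕ) → Subset n → Fin n → ℕ
(W ↾ p) v = if does (v ∈? p) then W v else 0

∑-↾ : (W : Fin n → ℕ) (p : Subset n) → ∑[ v < n ] (W ↾ p) v ≡ sum (map W (elements p))
∑-↾ W []            = refl
∑-↾ W (inside ∷ p)  = cong (W zero +_) (trans (∑-↾ (λ v → W (suc v)) p) (cong sum (map-∘ (elements p))))
∑-↾ W (outside ∷ p) = trans (∑-↾ (λ v → W (suc v)) p) (cong sum (map-∘ (elements p)))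

-- degree H v is degreeIn v (edges H) by definition.
degreeIn : Fin n → List (Subset n) → ℕ
degreeIn v es = length (filter (v ∈?_) es)

weight : (Fin n → ℕ) → Subset n → ℕ
weight W e = sum (map W (elements e))

degreeIn-∷ : (W : Fin n → ℕ) (f : Subset n) (es : List (Subset n)) (v : Fin n) →
             degreeIn v (f ∷ es) * W v ≡ (W ↾ f) v + degreeIn v es * W v
degreeIn-∷ W f es v with v ∈? f
... | yes _ = refl
... | no  _ = refl

weighted-handshake : (W : Fin n → ℕ) (es : List (Subset n)) →
             ∑[ v < n ] (degreeIn v es * W v) ≡ sum (map (weight W) es)
weighted-handshake {n} W []       = sum-replicate-zero n
weighted-handshake {n} W (f ∷ es) = begin
  ∑[ v < n ] (degreeIn v (f ∷ es) * W v)                  ≡⟨ sum-cong-≗ (degreeIn-∷ W f es) ⟩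
  ∑[ v < n ] ((W ↾ f) v + degreeIn v es * W v)            ≡⟨ ∑-distrib-+ (W ↾ f) (λ v → degreeIn v es * W v) ⟩
  ∑[ v < n ] (W ↾ f) v + ∑[ v < n ] (degreeIn v es * W v) ≡⟨ cong₂ _+_ (∑-↾ W f) (weighted-handshake W es) ⟩
  weight W f + sum (map (weight W) es)                    ∎
  where open ≡-Reasoning

degreeIn-++ : (v : Fin n) (xs ys : List (Subset n)) → degreeIn v (xs ++ ys) ≡ degreeIn v xs + degreeIn v ys
degreeIn-++ v xs ys = trans (cong length (filter-++ (v ∈?_) xs ys)) (length-++ (filter (v ∈?_) xs))

degreeIn-all : {v : Fin n} {xs : List (Subset n)} → All (v ∈ˢ_) xs → degreeIn v xs ≡ length xs
degreeIn-all {v = v} v∈xs = cong length (filter-all (v ∈?_) v∈xs)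

degreeIn-none : {v : Fin n} {xs : List (Subset n)} → All (v ∉ˢ_) xs → degreeIn v xs ≡ 0
degreeIn-none {v = v} v∉xs = cong length (filter-none (v ∈?_) v∉xs)

∈-abc⁺ : {v a b c : Fin n} → v ∈ a ∷ b ∷ c ∷ [] → v ∈ˢ (⁅ a ⁆ ∪ ⁅ b ⁆) ∪ ⁅ c ⁆
∈-abc⁺ {a = a} (here refl)                 = x∈p∪q⁺ (inj₁ (x∈p∪q⁺ (inj₁ (x∈⁅x⁆ a))))
∈-abc⁺ {b = b} (there (here refl))         = x∈p∪q⁺ (inj₁ (x∈p∪q⁺ (inj₂ (x∈⁅x⁆ b))))
∈-abc⁺ {c = c} (there (there (here refl))) = x∈p∪q⁺ (inj₂ (x∈⁅x⁆ c))

∈-abc⁻ : {v a b c : Fin n} → v ∈ˢ (⁅ a ⁆ ∪ ⁅ b ⁆) ∪ ⁅ c ⁆ → v ∈ a ∷ b ∷ c ∷ []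
∈-abc⁻ {a = a} {b} {c} v∈ with x∈p∪q⁻ (⁅ a ⁆ ∪ ⁅ b ⁆) ⁅ c ⁆ v∈
... | inj₂ v∈c = there (there (here (x∈⁅y⁆⇒x≡y c v∈c)))
... | inj₁ v∈ab with x∈p∪q⁻ ⁅ a ⁆ ⁅ b ⁆ v∈ab
...   | inj₁ v∈a = here (x∈⁅y⁆⇒x≡y a v∈a)
...   | inj₂ v∈b = there (here (x∈⁅y⁆⇒x≡y b v∈b))

record Labelling {n} (e : Subset n) : Set where
  constructor labelling
  field
    a b c : Fin n
    a≢b   : a ≢ b
    a≢c   : a ≢ c
    b≢c   : b ≢ c
    e≡abc : e ≡ (⁅ a ⁆ ∪ ⁅ b ⁆) ∪ ⁅ c ⁆

  ∈-labelling : ∀ {v} → v ∈ a ∷ b ∷ c ∷ [] → v ∈ˢ e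
  ∈-labelling v∈ = subst (_ ∈ˢ_) (sym e≡abc) (∈-abc⁺ v∈)

labelWeight : {e : Subset n} → (Fin n → ℕ) → Labelling e → ℕ
labelWeight W (labelling a b c _ _ _ _) = W a + W b + W c

swap₁₂ : {e : Subset n} → Labelling e → Labelling e
swap₁₂ (labelling a b c a≢b a≢c b≢c e≡abc) =
  labelling b a c (≢-sym a≢b) b≢c a≢c (trans e≡abc (cong (_∪ ⁅ c ⁆) (∪-comm ⁅ a ⁆ ⁅ b ⁆)))

swap₂₃ : {e : Subset n} → Labelling e → Labelling e
swap₂₃ (labelling a b c a≢b a≢c b≢c e≡abc) = labelling a c b a≢c a≢b (≢-sym b≢c) (begin
  _                           ≡⟨ e≡abc ⟩
  (⁅ a ⁆ ∪ ⁅ b ⁆) ∪ ⁅ c ⁆    ≡⟨ ∪-assoc ⁅ a ⁆ ⁅ b ⁆ ⁅ c ⁆ ⟩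
  ⁅ a ⁆ ∪ (⁅ b ⁆ ∪ ⁅ c ⁆)    ≡⟨ cong (⁅ a ⁆ ∪_) (∪-comm ⁅ b ⁆ ⁅ c ⁆) ⟩
  ⁅ a ⁆ ∪ (⁅ c ⁆ ∪ ⁅ b ⁆)    ≡⟨ ∪-assoc ⁅ a ⁆ ⁅ c ⁆ ⁅ b ⁆ ⟨
  (⁅ a ⁆ ∪ ⁅ c ⁆) ∪ ⁅ b ⁆    ∎)
  where open ≡-Reasoning

labelWeight-swap₁₂ : {e : Subset n} (W : Fin n → ℕ) (L : Labelling e) → labelWeight W (swap₁₂ L) ≡ labelWeight W L
labelWeight-swap₁₂ W (labelling a b c _ _ _ _) = xy∙z≈yx∙z (W b) (W a) (W c)

labelWeight-swap₂₃ : {e : Subset n} (W : Fin n → ℕ) (L : Labelling e) → labelWeight W (swap₂₃ L) ≡ labelWeight W L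
labelWeight-swap₂₃ W (labelling a b c _ _ _ _) = xy∙z≈xz∙y (W a) (W c) (W b)

labelling-of : (e : Subset n) → ∣ e ∣ ≡ 3 → Σ[ L ∈ Labelling e ] (∀ W → weight W e ≡ labelWeight W L)
labelling-of e ∣e∣≡3
  with elements e in elements≡ | trans (length-elements e) ∣e∣≡3 | elements-unique e
... | x ∷ y ∷ z ∷ [] | _ | (x≢y ∷ x≢z ∷ []) ∷ (y≢z ∷ []) ∷ [] ∷ [] =
  labelling x y z x≢y x≢z y≢z (⊆-antisym e⊆xyz xyz⊆e) , weight≡
  where
  e⊆xyz : ∀ {v} → v ∈ˢ e → v ∈ˢ (⁅ x ⁆ ∪ ⁅ y ⁆) ∪ ⁅ z ⁆
  e⊆xyz v∈e = ∈-abc⁺ (subst (_ ∈_) elements≡ (∈-elements⁺ e v∈e))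
  xyz⊆e : ∀ {v} → v ∈ˢ (⁅ x ⁆ ∪ ⁅ y ⁆) ∪ ⁅ z ⁆ → v ∈ˢ e
  xyz⊆e v∈ = ∈-elements⁻ e (subst (_ ∈_) (sym elements≡) (∈-abc⁻ v∈))
  weight≡ : ∀ W → W x + (W y + (W z + 0)) ≡ W x + W y + W z
  weight≡ W = begin
    W x + (W y + (W z + 0))   ≡⟨ cong (λ t → W x + (W y + t)) (+-identityʳ (W z)) ⟩
    W x + (W y + W z)         ≡⟨ +-assoc (W x) (W y) (W z) ⟨
    W x + W y + W z           ∎
    where open ≡-Reasoning

Decreasing : {e : Subset n} → (Fin n → ℕ) → Labelling e → Set
Decreasing D (labelling a b c _ _ _ _) = D b ≤ D a × D c ≤ D b

SortedBy : {e : Subset n} → (Fin n → ℕ) → Labelling e → Set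
SortedBy {e = e} D L = Σ[ L′ ∈ Labelling e ] Decreasing D L′ × (∀ W → labelWeight W L′ ≡ labelWeight W L)

insert₃ : {e : Subset n} (D : Fin n → ℕ) (L : Labelling e) → D (Labelling.b L) ≤ D (Labelling.a L) → SortedBy D L
insert₃ D L@(labelling a b c _ _ _ _) b≤a with D c ≤? D b | D c ≤? D a
... | yes c≤b | _       = L , (b≤a , c≤b) , λ W → refl
... | no c≰b  | yes c≤a = swap₂₃ L , (c≤a , <⇒≤ (≰⇒> c≰b)) , λ W → labelWeight-swap₂₃ W L
... | no c≰b  | no c≰a  = swap₁₂ (swap₂₃ L) , (<⇒≤ (≰⇒> c≰a) , b≤a) ,
                          λ W → trans (labelWeight-swap₁₂ W (swap₂₃ L)) (labelWeight-swap₂₃ W L)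

sortBy : {e : Subset n} (D : Fin n → ℕ) (L : Labelling e) → SortedBy D L
sortBy D L@(labelling a b c _ _ _ _) with D b ≤? D a
... | yes b≤a = insert₃ D L b≤a
... | no b≰a with insert₃ D (swap₁₂ L) (<⇒≤ (≰⇒> b≰a))
...   | L′ , decreasing , same = L′ , decreasing , λ W → trans (same W) (labelWeight-swap₁₂ W L)

share : ℕ → ℕ
share zero    = 0  -- junk value: every vertex of an edge has positive degree
share (suc d) = 12 / suc d

d*share≤12 : ∀ d → d * share d ≤ 12
d*share≤12 zero    = z≤n
d*share≤12 (suc d) = subst (_≤ 12) (*-comm (12 / suc d) (suc d)) (m/n*n≤m 12 (suc d))

share-antitone : ∀ {m n} → 1 ≤ m → m ≤ n → share n ≤ share m
share-antitone {suc m} {suc n} _ m≤n = /-monoʳ-≤ 12 m≤n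

share-sum-or-dominates : ∀ x y z → y ≤ x → z ≤ y → 1 ≤ z →
  8 ≤ share x + share y + share z ⊎ (4 ≤ x × 4 ≤ y × 3 ≤ z) ⊎ (5 ≤ x × 4 ≤ y × 2 ≤ z)
share-sum-or-dominates x y z y≤x z≤y 1≤z with y ≤? 3
share-sum-or-dominates x y z y≤x z≤y 1≤z | yes y≤3 = inj₁ (begin
  4 + 4                            ≤⟨ +-mono-≤ (share-antitone (≤-trans 1≤z z≤y) y≤3)
                                               (share-antitone 1≤z (≤-trans z≤y y≤3)) ⟩
  share y + share z                ≤⟨ m≤n+m _ (share x) ⟩
  share x + (share y + share z)    ≡⟨ +-assoc (share x) (share y) (share z) ⟨
  share x + share y + share z      ∎)
  where open ≤-Reasoning
share-sum-or-dominates x y 1 _ _ _ | no _ = inj₁ (≤-trans (m≤m+n 8 4) (m≤n+m 12 (share x + share y)))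
share-sum-or-dominates x y 2 y≤x _ _ | no y≰3 with x ≤? 4
... | yes x≤4 = inj₁ (≤-trans (m≤m+n 8 4)
                 (+-mono-≤ (+-mono-≤ (share-antitone 1≤x x≤4) (share-antitone 1≤y (≤-trans y≤x x≤4))) (≤-refl {6})))
  where
  1≤y : 1 ≤ y
  1≤y = ≤-trans (s≤s z≤n) (≰⇒> y≰3)
  1≤x : 1 ≤ x
  1≤x = ≤-trans 1≤y y≤x
... | no x≰4 = inj₂ (inj₂ (≰⇒> x≰4 , ≰⇒> y≰3 , ≤-refl))
share-sum-or-dominates x y (suc (suc (suc z))) y≤x _ _ | no y≰3 =
  inj₂ (inj₁ (≤-trans (≰⇒> y≰3) y≤x , ≰⇒> y≰3 , s≤s (s≤s (s≤s z≤n))))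

distinct⇒2≤∣p∣ : {u v : Fin n} {p : Subset n} → u ∈ˢ p → v ∈ˢ p → u ≢ v → 2 ≤ ∣ p ∣
distinct⇒2≤∣p∣ u∈p v∈p u≢v =
  ≤-trans (s≤s (≤-trans (s≤s z≤n) (x∈p⇒∣p-x∣<∣p∣ (x∈p∧x≢y⇒x∈p-y v∈p (≢-sym u≢v))))) (x∈p⇒∣p-x∣<∣p∣ u∈p)

common-vertex-unique : (H : ThreeGraph n) {e f : Subset n} → e ∈ edges H → f ∈ edges H → e ≢ f →
                       {u v : Fin n} → u ∈ˢ e → u ∈ˢ f → v ∈ˢ e → v ∈ˢ f → u ≡ v
common-vertex-unique H e∈H f∈H e≢f {u} {v} u∈e u∈f v∈e v∈f with u ≟ᶠ v
... | yes u≡v = u≡v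
... | no  u≢v = contradiction (linear H e∈H f∈H e≢f)
                  (<⇒≱ (distinct⇒2≤∣p∣ (x∈p∩q⁺ (u∈e , u∈f)) (x∈p∩q⁺ (v∈e , v∈f)) u≢v))

restrict : (H : ThreeGraph n) (es : List (Subset n)) → Unique es → es ⊆ edges H → ThreeGraph n
restrict H es unique-es es⊆H = record
  { edges  = es
  ; unique = unique-es
  ; size3  = All.tabulate (λ e∈ → All.lookup (size3 H) (es⊆H e∈))
  ; linear = λ e∈ f∈ → linear H (es⊆H e∈) (es⊆H f∈)
  }

crownFree-⊆ : (H H′ : ThreeGraph n) → edges H′ ⊆ edges H → CrownFree H → CrownFree H′
crownFree-⊆ H H′ H′⊆H crownFree (e₁ , e₂ , e₃ , f , e₁∈ , e₂∈ , e₃∈ , f∈ , crown) =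
  crownFree (e₁ , e₂ , e₃ , f , H′⊆H e₁∈ , H′⊆H e₂∈ , H′⊆H e₃∈ , H′⊆H f∈ , crown)

star⇒containsCritical : (H H′ : ThreeGraph n) {e : Subset n} → edges H′ ⊆ edges H → CrownFree H →
                e ∈ edges H′ → (∀ {f} → f ∈ edges H′ → Meets f e) →
                DegreeVector H′ e 4 4 3 ⊎ DegreeVector H′ e 5 4 2 → ContainsCriticalConfiguration H
star⇒containsCritical H H′ {e} H′⊆H crownFree e∈H′ meets-e degrees =
  edges H′ , H′⊆H , H′ , crownFree-⊆ H H′ H′⊆H crownFree , e , e∈H′ , degrees ,
  λ f → mk⇔ (λ f∈ → f∈ , meets-e f∈) proj₁

_≟ˢ_ : DecidableEquality (Subset n)
_≟ˢ_ = ≡-dec _≟ᵇ_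

module Neighbourhood {n} (H : ThreeGraph n) {e : Subset n} (e∈H : e ∈ edges H) where

  spokes : Fin n → List (Subset n)
  spokes v = filter (λ f → ¬? (f ≟ˢ e)) (filter (v ∈?_) (edges H))

  ∈-spokes⁻ : ∀ {v f} → f ∈ spokes v → (f ∈ edges H × v ∈ˢ f) × f ≢ e
  ∈-spokes⁻ {v} f∈ with ∈-filter⁻ (λ f → ¬? (f ≟ˢ e)) {xs = filter (v ∈?_) (edges H)} f∈
  ... | f∈′ , f≢e = ∈-filter⁻ (v ∈?_) {xs = edges H} f∈′ , f≢e

  spoke∈H : ∀ {v f} → f ∈ spokes v → f ∈ edges H
  spoke∈H = proj₁ ∘ proj₁ ∘ ∈-spokes⁻

  spoke-through : ∀ {v f} → f ∈ spokes v → v ∈ˢ f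
  spoke-through = proj₂ ∘ proj₁ ∘ ∈-spokes⁻

  spoke≢e : ∀ {v f} → f ∈ spokes v → f ≢ e
  spoke≢e = proj₂ ∘ ∈-spokes⁻

  spokes-unique : ∀ v → Unique (spokes v)
  spokes-unique v = Unique.filter⁺ _ (Unique.filter⁺ _ (unique H))

  degree≡suc-spokes : ∀ {v} → v ∈ˢ e → degree H v ≡ suc (length (spokes v))
  degree≡suc-spokes {v} v∈e =
    length-filter-≢ _≟ˢ_ (filter (v ∈?_) (edges H)) (Unique.filter⁺ _ (unique H)) (∈-filter⁺ _ e∈H v∈e)

  degree-positive : ∀ {v} → v ∈ˢ e → 1 ≤ degree H v
  degree-positive v∈e = subst (1 ≤_) (sym (degree≡suc-spokes v∈e)) (s≤s z≤n)

  spokes-avoid : ∀ {u v f} → u ∈ˢ e → v ∈ˢ e → u ≢ v → f ∈ spokes v → u ∉ˢ f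
  spokes-avoid u∈e v∈e u≢v f∈ u∈f =
    u≢v (common-vertex-unique H e∈H (spoke∈H f∈) (≢-sym (spoke≢e f∈)) u∈e u∈f v∈e (spoke-through f∈))

  module _ (L : Labelling e) where
    open Labelling L

    a∈e : a ∈ˢ e
    a∈e = ∈-labelling (here refl)
    b∈e : b ∈ˢ e
    b∈e = ∈-labelling (there (here refl))
    c∈e : c ∈ˢ e
    c∈e = ∈-labelling (there (there (here refl)))

    picked : Fin n → ℕ → List (Subset n)
    picked v m = take m (spokes v)

    picked-through : ∀ v m → All (v ∈ˢ_) (picked v m)
    picked-through v m = AllP.take⁺ m (All.tabulate spoke-through)

    picked-avoid : ∀ {u v} m → u ∈ˢ e → v ∈ˢ e → u ≢ v → All (u ∉ˢ_) (picked v m)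
    picked-avoid m u∈e v∈e u≢v = AllP.take⁺ m (All.tabulate (spokes-avoid u∈e v∈e u≢v))

    length-picked : ∀ {v m} → v ∈ˢ e → m < degree H v → length (picked v m) ≡ m
    length-picked {v} {m} v∈e m<deg = trans (length-take m (spokes v))
      (m≤n⇒m⊓n≡m (s≤s⁻¹ (subst (m <_) (degree≡suc-spokes v∈e) m<deg)))

    arms : ℕ → ℕ → ℕ → List (Subset n)
    arms i j k = picked a i ++ picked b j ++ picked c k

    arms-all : {P : Subset n → Set} → (∀ {v f} → v ∈ˢ e → f ∈ spokes v → P f) → ∀ i j k → All P (arms i j k)
    arms-all P-spoke i j k = AllP.++⁺ (arm a∈e i) (AllP.++⁺ (arm b∈e j) (arm c∈e k))
      where
      arm : ∀ {v} → v ∈ˢ e → ∀ m → All _ (picked v m)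
      arm v∈e m = AllP.take⁺ m (All.tabulate (P-spoke v∈e))

    arms-unique : ∀ i j k → Unique (arms i j k)
    arms-unique i j k =
      Unique.++⁺ (picked-unique a i)
        (Unique.++⁺ (picked-unique b j) (picked-unique c k)
          (separated⇒disjoint (picked-through b j) (picked-avoid k b∈e c∈e b≢c)))
        (separated⇒disjoint (picked-through a i)
          (AllP.++⁺ (picked-avoid j a∈e b∈e a≢b) (picked-avoid k a∈e c∈e a≢c)))
      where
      picked-unique : ∀ v m → Unique (picked v m)
      picked-unique v m = Unique.take⁺ m (spokes-unique v)

    star : ℕ → ℕ → ℕ → List (Subset n)
    star i j k = e ∷ arms i j k

    star-⊆ : ∀ i j k → star i j k ⊆ edges H
    star-⊆ i j k = All.lookup (e∈H ∷ arms-all (λ _ → spoke∈H) i j k)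

    star-unique : ∀ i j k → Unique (star i j k)
    star-unique i j k = arms-all (λ _ → ≢-sym ∘ spoke≢e) i j k ∷ arms-unique i j k

    star-meets : ∀ i j k {f} → f ∈ star i j k → Meets f e
    star-meets i j k = All.lookup ((a , x∈p∩q⁺ (a∈e , a∈e)) ∷ arms-all meets i j k)
      where
      meets : ∀ {v f} → v ∈ˢ e → f ∈ spokes v → Meets f e
      meets {v} v∈e f∈ = v , x∈p∩q⁺ (spoke-through f∈ , v∈e)

    starGraph : ℕ → ℕ → ℕ → ThreeGraph n
    starGraph i j k = restrict H (star i j k) (star-unique i j k) (star-⊆ i j k)

    degree-starGraph : ∀ {v} → v ∈ˢ e → ∀ i j k → degree (starGraph i j k) v ≡
      suc (degreeIn v (picked a i) + (degreeIn v (picked b j) + degreeIn v (picked c k)))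
    degree-starGraph {v} v∈e i j k = begin
      degreeIn v (e ∷ arms i j k)
        ≡⟨ cong length (filter-accept (v ∈?_) v∈e) ⟩
      suc (degreeIn v (arms i j k))
        ≡⟨ cong suc (degreeIn-++ v (picked a i) _) ⟩
      suc (degreeIn v (picked a i) + degreeIn v (picked b j ++ picked c k))
        ≡⟨ cong (λ t → suc (degreeIn v (picked a i) + t)) (degreeIn-++ v (picked b j) _) ⟩
      suc (degreeIn v (picked a i) + (degreeIn v (picked b j) + degreeIn v (picked c k))) ∎
      where open ≡-Reasoning

    -- e plus i, j, k further edges through a, b, c; by linearity each of these misses the other
    -- two vertices of e, so the degrees of a, b, c become exactly i + 1, j + 1, k + 1.
    star-degreeVector : ∀ i j k → i < degree H a → j < degree H b → k < degree H c →
                        DegreeVector (starGraph i j k) e (suc i) (suc j) (suc k)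
    star-degreeVector i j k i<a j<b k<c =
      a , b , c , a≢b , a≢c , b≢c , e≡abc , degree-a , degree-b , degree-c
      where
      all-picked : ∀ {v} m → v ∈ˢ e → m < degree H v → degreeIn v (picked v m) ≡ m
      all-picked m v∈e m<deg = trans (degreeIn-all (picked-through _ m)) (length-picked v∈e m<deg)
      none-picked : ∀ {u v} m → u ∈ˢ e → v ∈ˢ e → u ≢ v → degreeIn u (picked v m) ≡ 0
      none-picked m u∈e v∈e u≢v = degreeIn-none (picked-avoid m u∈e v∈e u≢v)
      degree-a : degree (starGraph i j k) a ≡ suc i
      degree-a = trans (degree-starGraph a∈e i j k) (cong suc (trans
        (cong₂ _+_ (all-picked i a∈e i<a) (cong₂ _+_ (none-picked j a∈e b∈e a≢b) (none-picked k a∈e c∈e a≢c)))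
        (+-identityʳ i)))
      degree-b : degree (starGraph i j k) b ≡ suc j
      degree-b = trans (degree-starGraph b∈e i j k) (cong suc (trans
        (cong₂ _+_ (none-picked i b∈e a∈e (≢-sym a≢b)) (cong₂ _+_ (all-picked j b∈e j<b) (none-picked k b∈e c∈e b≢c)))
        (+-identityʳ j)))
      degree-c : degree (starGraph i j k) c ≡ suc k
      degree-c = trans (degree-starGraph c∈e i j k) (cong suc
        (cong₂ _+_ (none-picked i c∈e a∈e (≢-sym a≢c)) (cong₂ _+_ (none-picked j c∈e b∈e (≢-sym b≢c)) (all-picked k c∈e k<c))))

    dominated⇒containsCritical : CrownFree H →
      (4 ≤ degree H a × 4 ≤ degree H b × 3 ≤ degree H c) ⊎ (5 ≤ degree H a × 4 ≤ degree H b × 2 ≤ degree H c) →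
      ContainsCriticalConfiguration H
    dominated⇒containsCritical crownFree (inj₁ (4≤a , 4≤b , 3≤c)) =
      star⇒containsCritical H (starGraph 3 3 2) (star-⊆ 3 3 2) crownFree (here refl) (star-meets 3 3 2)
        (inj₁ (star-degreeVector 3 3 2 4≤a 4≤b 3≤c))
    dominated⇒containsCritical crownFree (inj₂ (5≤a , 4≤b , 2≤c)) =
      star⇒containsCritical H (starGraph 4 3 1) (star-⊆ 4 3 1) crownFree (here refl) (star-meets 4 3 1)
        (inj₂ (star-degreeVector 4 3 1 5≤a 4≤b 2≤c))

  weight-≥8 : CrownFree H → ¬ ContainsCriticalConfiguration H → 8 ≤ weight (share ∘ degree H) e
  weight-≥8 crownFree no-critical with labelling-of e (All.lookup (size3 H) e∈H)
  ... | L , weight≡ with sortBy (degree H) L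
  ...   | L′@(labelling a b c _ _ _ _) , (b≤a , c≤b) , same
          with share-sum-or-dominates (degree H a) (degree H b) (degree H c) b≤a c≤b (degree-positive (c∈e L′))
  ...     | inj₁ 8≤ = subst (8 ≤_) (trans (same (share ∘ degree H)) (sym (weight≡ (share ∘ degree H)))) 8≤
  ...     | inj₂ dominated = contradiction (dominated⇒containsCritical L′ crownFree dominated) no-critical

corollary3 : (n : ℕ) (H : ThreeGraph n) → CrownFree H → ¬ ContainsCriticalConfiguration H →
    2 * length (edges H) ≤ 3 * n
corollary3 n H crownFree no-critical = *-cancelˡ-≤ 4 (begin
  4 * (2 * length (edges H))              ≡⟨ *-assoc 4 2 (length (edges H)) ⟨
  8 * length (edges H)                    ≡⟨ *-comm 8 (length (edges H)) ⟩
  length (edges H) * 8                    ≤⟨ sum-map-≥ 8 (weight W) (edges H) (All.tabulate weight-≥8) ⟩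
  sum (map (weight W) (edges H))          ≡⟨ weighted-handshake W (edges H) ⟨
  ∑[ v < n ] (degree H v * W v)           ≤⟨ ∑-≤ _ 12 (λ v → d*share≤12 (degree H v)) ⟩
  n * 12                                  ≡⟨ *-comm n 12 ⟩
  4 * 3 * n                               ≡⟨ *-assoc 4 3 n ⟩
  4 * (3 * n)                             ∎)
  where
  open ≤-Reasoning
  W : Fin n → ℕ
  W = share ∘ degree H
  weight-≥8 : ∀ {e} → e ∈ edges H → 8 ≤ weight W e
  weight-≥8 e∈H = Neighbourhood.weight-≥8 H e∈H crownFree no-critical
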